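{- Let $q\ge 2$ and let $N$ be the incidence matrix of a finite projective plane of order $q$, with rows $r_1,r_2,\ldots,r_n$, where $n=q^2+q+1$ (so each $r_i\in\{0,1\}^{n}$). Then for each $2\le i\le n$ there is $\Gamma_i\in SOS_q(A_{q^2+q})$ with $|\Gamma_i|=r_1-r_i$, and $\{\Gamma_2,\ldots,\Gamma_n\}$ is an SOS-clique of size $q^2+q$ in $SOS_q(A_{q^2+q})$.
   Context: A finite projective plane of order $q$ is an incidence structure of points and lines in which every line contains $q+1$ points and every point lies on $q+1$ lines, any two distinct lines meet in exactly one point, any two distinct points lie on a unique line, and there exist four points no three of which are collinear; it has $q^2+q+1$ points and $q^2+q+1$ lines. Its incidence matrix has rows indexed by lines and columns by points, with entry $1$ if the point lies on the line and $0$ otherwise. Let $\varepsilon_1,\ldots,\varepsilon_{\ell+1}$ be the standard basis of $\mathbb{R}^{\ell+1}$. The root system $A_\ell$ is the set of vectors $\varepsilon_i-\varepsilon_j$, $i\neq j$. Two roots are strongly orthogonal if neither their sum nor their difference is a root (equivalently, in $A_\ell$, their supports are disjoint). $SOS_k(A_\ell)$ is the set of $k$-element subsets $\Gamma$ of $A_\ell$ whose elements are pairwise strongly orthogonal. For $\Gamma\in SOS_k(A_\ell)$ write $|\Gamma|=\sum_{\gamma\in\Gamma}\gamma\in\mathbb{R}^{\ell+1}$. A subset $\mathcal{F}\subseteq SOS_k(A_\ell)$ is an SOS-clique if for all distinct $\Gamma_i,\Gamma_j\in\mathcal{F}$ there exists $\Gamma_{i,j}\in SOS_k(A_\ell)$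 with $|\Gamma_i|-|\Gamma_j|=|\Gamma_{i,j}|$. -}

module Defs where

open import Data.Nat as ℕ using (ℕ; zero; suc)
open import Data.Fin using (Fin; zero; suc)
open import Data.Bool using (Bool; true; false; if_then_else_)
open import Data.Integer as ℤ using (ℤ; +_)
open import Data.Product using (Σ; _×_; _,_; ∃)
open import Data.Vec using (Vec; []; _∷_; lookup)
open import Function.Definitions using (Injective)
open import Relation.Binary.PropositionalEquality using (_≡_; _≢_)
open import Relation.Nullary using (¬_)

count : ∀ {n} → (Fin n → Bool) → ℕ
count {zero}  f = 0
count {suc n} f = (if f zero then 1 else 0) ℕ.+ count (λ i → f (suc i))

PPn : ℕ → ℕ
PPn q = suc (q ℕ.* q ℕ.+ q)

-- N l p = true  iff point p lies on line l  (rows = lines, columns = points)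
record IsProjectivePlane (q : ℕ) (N : Fin (PPn q) → Fin (PPn q) → Bool) : Set where
  field
    lineSize   : ∀ l → count (λ p → N l p) ≡ suc q
    pointDeg   : ∀ p → count (λ l → N l p) ≡ suc q
    linesMeet  : ∀ l l′ → l ≢ l′ →
                 Σ (Fin (PPn q)) λ p → N l p ≡ true × N l′ p ≡ true ×
                   (∀ p′ → N l p′ ≡ true → N l′ p′ ≡ true → p′ ≡ p)
    pointsJoin : ∀ p p′ → p ≢ p′ →
                 Σ (Fin (PPn q)) λ l → N l p ≡ true × N l p′ ≡ true ×
                   (∀ l′ → N l′ p ≡ true → N l′ p′ ≡ true → l′ ≡ l)
    quadrangle : Σ (Fin 4 → Fin (PPn q)) λ f → Injective _≡_ _≡_ f ×
                 (∀ a b c → a ≢ b → a ≢ c → b ≢ c → ∀ l →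
                   ¬ (N l (f a) ≡ true × N l (f b) ≡ true × N l (f c) ≡ true))

b2ℤ : Bool → ℤ
b2ℤ true  = + 1
b2ℤ false = + 0

row : ∀ {n} → (Fin n → Fin n → Bool) → Fin n → (Fin n → ℤ)
row N l p = b2ℤ (N l p)

-- The root system A_ℓ inside ℤ^(ℓ+1); here m = ℓ + 1 is the ambient dimension.

record Root (m : ℕ) : Set where
  constructor root
  field
    i j : Fin m
    i≢j : i ≢ j

δ : ∀ {m} → Fin m → Fin m → ℤ
δ a b with a Data.Fin.≟ b
... | Relation.Nullary.yes _ = + 1
... | Relation.Nullary.no  _ = + 0

rootVec : ∀ {m} → Root m → Fin m → ℤ
rootVec (root i j _) k = δ k i ℤ.- δ k j

-- strong orthogonality in A_ℓ: supports are disjoint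
StronglyOrthogonal : ∀ {m} → Root m → Root m → Set
StronglyOrthogonal (root i j _) (root i′ j′ _) =
  i ≢ i′ × i ≢ j′ × j ≢ i′ × j ≢ j′

-- SOS_k(A_ℓ): k pairwise strongly orthogonal roots (listed in some order;
-- they are automatically distinct, so this is a k-element subset)
record SOS (k m : ℕ) : Set where
  constructor sos
  field
    roots    : Vec (Root m) k
    pairwise : ∀ a b → a ≢ b → StronglyOrthogonal (lookup roots a) (lookup roots b)

_∈SOS_ : ∀ {k m} → Fin m × Fin m → SOS k m → Set
(i , j) ∈SOS Γ = ∃ λ a → Root.i (lookup (SOS.roots Γ) a) ≡ i × Root.j (lookup (SOS.roots Γ) a) ≡ j

SameSet : ∀ {k m} → SOS k m → SOS k m → Set
SameSet Γ Δ = ∀ x → (x ∈SOS Γ → x ∈SOS Δ) × (x ∈SOS Δ → x ∈SOS Γ)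

sumVecs : ∀ {k m} → Vec (Root m) k → Fin m → ℤ
sumVecs []       x = + 0
sumVecs (r ∷ rs) x = rootVec r x ℤ.+ sumVecs rs x

∣_∣Γ : ∀ {k m} → SOS k m → Fin m → ℤ
∣ Γ ∣Γ = sumVecs (SOS.roots Γ)

-- An SOS-clique, given as an indexed family F : I → SOS_k(A_ℓ) (the set is its image):
-- for all members that are distinct (as sets) there is Γ_{a,b} with |F a| − |F b| = |Γ_{a,b}|.
IsSOSClique : ∀ {k m} {I : Set} → (I → SOS k m) → Set
IsSOSClique {k} {m} {I} F =
  ∀ a b → ¬ SameSet (F a) (F b) →
  Σ (SOS k m) λ G → ∀ x → ∣ F a ∣Γ x ℤ.- ∣ F b ∣Γ x ≡ ∣ G ∣Γ x

-- Two distinct lines l, l′ meet in exactly one point p, so r_l − r_l′ = χ(l ∖ {p}) − χ(l′ ∖ {p})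
-- with l ∖ {p} and l′ ∖ {p} disjoint q-sets.  Matching them up in any order gives q roots
-- ε_a − ε_b with pairwise disjoint supports, i.e. an element of SOS_q(A_{q²+q}) with sum r_l − r_l′.
-- Taking (l, l′) = (1, i) gives Γ_i, and |Γ_a| − |Γ_b| = r_b − r_a is again of this form.
-- The negative endpoints of Γ_i lie on line i; if Γ_i = Γ_j as sets they lie on lines i and j,
-- hence all coincide with the meeting point, contradicting strong orthogonality when q ≥ 2.
module Submission where

open import Defs
import Data.Nat as ℕ
open import Data.Nat using (ℕ; _≤_; _*_; _+_; s≤s)
import Data.Nat.Properties as ℕP
open import Data.Fin using (Fin; zero; suc; _≟_)
open import Data.Fin.Properties using (suc-injective)
open import Data.Bool using (Bool; true; false; if_then_else_)
open import Data.Integer as ℤ using (ℤ; _-_)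
import Data.Integer.Properties as ℤP
open import Data.Integer.Solver using (module +-*-Solver)
open import Data.Product using (Σ; _×_; _,_; proj₁; proj₂)
open import Data.Vec using (Vec; []; _∷_; lookup; map; tabulate)
open import Data.Vec.Properties using (lookup-map; lookup∘tabulate)
open import Data.Empty using (⊥-elim)
open import Function using (id; _∘_)
open import Function.Definitions using (Injective)
open import Relation.Binary.PropositionalEquality
  using (_≡_; _≢_; refl; sym; trans; cong; cong₂; subst; module ≡-Reasoning)
open import Relation.Nullary using (¬_; Dec; yes; no)

δ-refl : ∀ {m} (a : Fin m) → δ a a ≡ ℤ.+ 1
δ-refl a with a ≟ a
... | yes _   = refl
... | no a≢a = ⊥-elim (a≢a refl)

δ-≢ : ∀ {m} {a b : Fin m} → a ≢ b → δ a b ≡ ℤ.+ 0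
δ-≢ {a = a} {b} a≢b with a ≟ b
... | yes a≡b = ⊥-elim (a≢b a≡b)
... | no _    = refl

δ-suc : ∀ {m} (a b : Fin m) → δ (suc a) (suc b) ≡ δ a b
δ-suc a b = by-cases (a ≟ b)
  where
  by-cases : Dec (a ≡ b) → δ (suc a) (suc b) ≡ δ a b
  by-cases (yes refl) = trans (δ-refl (suc a)) (sym (δ-refl a))
  by-cases (no a≢b)   = trans (δ-≢ (a≢b ∘ suc-injective)) (sym (δ-≢ a≢b))

occurrences : ∀ {m k} → Fin m → Vec (Fin m) k → ℤ
occurrences x []      = ℤ.+ 0
occurrences x (a ∷ v) = δ x a ℤ.+ occurrences x v

occurrences-zero-map-suc : ∀ {m k} (v : Vec (Fin m) k) → occurrences zero (map suc v) ≡ ℤ.+ 0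
occurrences-zero-map-suc []      = refl
occurrences-zero-map-suc (a ∷ v)
  rewrite δ-≢ {a = zero} {b = suc a} (λ ()) | occurrences-zero-map-suc v = refl

occurrences-suc-map-suc : ∀ {m k} (x : Fin m) (v : Vec (Fin m) k) →
  occurrences (suc x) (map suc v) ≡ occurrences x v
occurrences-suc-map-suc x []      = refl
occurrences-suc-map-suc x (a ∷ v) rewrite δ-suc x a | occurrences-suc-map-suc x v = refl

count-cong : ∀ {n} {f g : Fin n → Bool} → (∀ x → f x ≡ g x) → count f ≡ count g
count-cong {ℕ.zero}          f≗g = refl
count-cong {ℕ.suc n} {f} {g} f≗g rewrite f≗g zero | count-cong (f≗g ∘ suc) = refl

record Enumeration {n} (f : Fin n → Bool) (k : ℕ) : Set where
  field
    elems         : Vec (Fin n) k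
    elems-inj     : Injective _≡_ _≡_ (lookup elems)
    elems-true    : ∀ a → f (lookup elems a) ≡ true
    occurrences≡f : ∀ x → occurrences x elems ≡ b2ℤ (f x)
open Enumeration

module _ {n k} {f : Fin (ℕ.suc n) → Bool} (E : Enumeration (f ∘ suc) k) where

  private
    shifted : Vec (Fin (ℕ.suc n)) k
    shifted = map suc (elems E)

    lookup-shifted : ∀ a → lookup shifted a ≡ suc (lookup (elems E) a)
    lookup-shifted a = lookup-map a suc (elems E)

    shifted-inj : Injective _≡_ _≡_ (lookup shifted)
    shifted-inj {a} {b} e =
      elems-inj E (suc-injective (trans (sym (lookup-shifted a)) (trans e (lookup-shifted b))))

    shifted-true : ∀ a → f (lookup shifted a) ≡ true
    shifted-true a = subst (λ y → f y ≡ true) (sym (lookup-shifted a)) (elems-true E a)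

    shifted-occurrences-suc : ∀ x → occurrences (suc x) shifted ≡ b2ℤ (f (suc x))
    shifted-occurrences-suc x = trans (occurrences-suc-map-suc x (elems E)) (occurrences≡f E x)

  enumeration-skip : f zero ≡ false → Enumeration f k
  enumeration-skip f0 = record
    { elems         = shifted
    ; elems-inj     = shifted-inj
    ; elems-true    = shifted-true
    ; occurrences≡f = occ
    }
    where
    occ : ∀ x → occurrences x shifted ≡ b2ℤ (f x)
    occ zero    rewrite occurrences-zero-map-suc (elems E) | f0 = refl
    occ (suc x) = shifted-occurrences-suc x

  enumeration-cons : f zero ≡ true → Enumeration f (ℕ.suc k)
  enumeration-cons f0 = record
    { elems         = zero ∷ shifted
    ; elems-inj     = inj
    ; elems-true    = λ { zero → f0 ; (suc a) → shifted-true a }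
    ; occurrences≡f = occ
    }
    where
    inj : Injective _≡_ _≡_ (lookup (zero ∷ shifted))
    inj {zero}  {zero}  _ = refl
    inj {zero}  {suc b} e with () ← trans e (lookup-shifted b)
    inj {suc a} {zero}  e with () ← trans (sym (lookup-shifted a)) e
    inj {suc a} {suc b} e = cong suc (shifted-inj e)
    occ : ∀ x → occurrences x (zero ∷ shifted) ≡ b2ℤ (f x)
    occ zero    rewrite δ-refl {ℕ.suc n} zero | occurrences-zero-map-suc (elems E) | f0 = refl
    occ (suc x) rewrite δ-≢ {a = suc x} {b = zero} (λ ()) =
      trans (ℤP.+-identityˡ _) (shifted-occurrences-suc x)

enumerate : ∀ {n} (f : Fin n → Bool) → Enumeration f (count f)
enumerate {ℕ.zero}  f = record { elems = [] ; elems-inj = λ {} ; elems-true = λ () ; occurrences≡f = λ () }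
enumerate {ℕ.suc n} f with f zero in f0
... | true  = enumeration-cons (enumerate (f ∘ suc)) f0
... | false = enumeration-skip (enumerate (f ∘ suc)) f0

enumerationOfSize : ∀ {n k} {f : Fin n → Bool} → count f ≡ k → Enumeration f k
enumerationOfSize {f = f} refl = enumerate f

without : ∀ {n} → Fin n → (Fin n → Bool) → Fin n → Bool
without p g x with x ≟ p
... | yes _ = false
... | no _  = g x

module _ {n} (p : Fin n) (g : Fin n → Bool) where

  without-self : without p g p ≡ false
  without-self with p ≟ p
  ... | yes _   = refl
  ... | no p≢p = ⊥-elim (p≢p refl)

  without-≢ : ∀ {x} → x ≢ p → without p g x ≡ g x
  without-≢ {x} x≢p with x ≟ p
  ... | yes x≡p = ⊥-elim (x≢p x≡p)
  ... | no _    = refl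

  without-true : ∀ {x} → without p g x ≡ true → x ≢ p × g x ≡ true
  without-true {x} with x ≟ p
  ... | yes _  = λ ()
  ... | no x≢p = x≢p ,_

without-suc : ∀ {n} (p : Fin n) g i → without (suc p) g (suc i) ≡ without p (g ∘ suc) i
without-suc p g i = by-cases (i ≟ p)
  where
  by-cases : Dec (i ≡ p) → without (suc p) g (suc i) ≡ without p (g ∘ suc) i
  by-cases (yes refl) = trans (without-self (suc p) g) (sym (without-self p (g ∘ suc)))
  by-cases (no i≢p)   =
    trans (without-≢ (suc p) g (i≢p ∘ suc-injective)) (sym (without-≢ p (g ∘ suc) i≢p))

count-without : ∀ {n} (p : Fin n) g → g p ≡ true → count g ≡ ℕ.suc (count (without p g))
count-without zero    g gp rewrite gp = refl
count-without (suc p) g gp = begin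
  g₀ + count (g ∘ suc)                     ≡⟨ cong (g₀ +_) (count-without p (g ∘ suc) gp) ⟩
  g₀ + ℕ.suc (count (without p (g ∘ suc))) ≡⟨ ℕP.+-suc g₀ _ ⟩
  ℕ.suc (g₀ + count (without p (g ∘ suc))) ≡⟨ cong (λ c → ℕ.suc (g₀ + c)) (count-cong (without-suc p g)) ⟨
  ℕ.suc (count (without (suc p) g))        ∎
  where
  open ≡-Reasoning
  g₀ : ℕ
  g₀ = if g zero then 1 else 0

b2ℤ-without-difference : ∀ {n} (p : Fin n) g h → g p ≡ h p →
  ∀ x → b2ℤ (without p g x) - b2ℤ (without p h x) ≡ b2ℤ (g x) - b2ℤ (h x)
b2ℤ-without-difference p g h gp≡hp x = by-cases (x ≟ p)
  where
  by-cases : Dec (x ≡ p) → b2ℤ (without p g x) - b2ℤ (without p h x) ≡ b2ℤ (g x) - b2ℤ (h x)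
  by-cases (yes refl) rewrite without-self p g | without-self p h | gp≡hp =
    sym (ℤP.i≡j⇒i-j≡0 {b2ℤ (h p)} refl)
  by-cases (no x≢p)   rewrite without-≢ p g x≢p | without-≢ p h x≢p = refl

differenceRoots : ∀ {m k} (as bs : Vec (Fin m) k) → (∀ a → lookup as a ≢ lookup bs a) → Vec (Root m) k
differenceRoots as bs as≢bs = tabulate (λ a → root (lookup as a) (lookup bs a) (as≢bs a))

sumVecs-differenceRoots : ∀ {m k} (as bs : Vec (Fin m) k) as≢bs x →
  sumVecs (differenceRoots as bs as≢bs) x ≡ occurrences x as - occurrences x bs
sumVecs-differenceRoots []       []       as≢bs x = refl
sumVecs-differenceRoots (a ∷ as) (b ∷ bs) as≢bs x
  rewrite sumVecs-differenceRoots as bs (as≢bs ∘ suc) x =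
  solve 4 (λ u v w z → (u :- v) :+ (w :- z) := (u :+ w) :- (v :+ z)) refl
    (δ x a) (δ x b) (occurrences x as) (occurrences x bs)
  where open +-*-Solver

module DisjointMatching {m k} {as bs : Vec (Fin m) k}
         (as-inj : Injective _≡_ _≡_ (lookup as)) (bs-inj : Injective _≡_ _≡_ (lookup bs))
         (disjoint : ∀ a b → lookup as a ≢ lookup bs b) where

  private
    roots : Vec (Root m) k
    roots = differenceRoots as bs (λ a → disjoint a a)

    lookup-roots : ∀ a → lookup roots a ≡ root (lookup as a) (lookup bs a) (disjoint a a)
    lookup-roots = lookup∘tabulate _

  disjointMatching : SOS k m
  disjointMatching = sos roots pairwise
    where
    pairwise : ∀ a b → a ≢ b → StronglyOrthogonal (lookup roots a) (lookup roots b)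
    pairwise a b a≢b rewrite lookup-roots a | lookup-roots b =
      a≢b ∘ as-inj , disjoint a b , (λ e → disjoint b a (sym e)) , a≢b ∘ bs-inj

  ∣disjointMatching∣ : ∀ x → ∣ disjointMatching ∣Γ x ≡ occurrences x as - occurrences x bs
  ∣disjointMatching∣ = sumVecs-differenceRoots as bs _

  disjointMatching-j : ∀ a → Root.j (lookup (SOS.roots disjointMatching) a) ≡ lookup bs a
  disjointMatching-j a = cong Root.j (lookup-roots a)

sameSet-j : ∀ {k m} (Γ Δ : SOS k m) → SameSet Γ Δ → ∀ a →
  Σ (Fin k) λ c → Root.j (lookup (SOS.roots Δ) c) ≡ Root.j (lookup (SOS.roots Γ) a)
sameSet-j Γ Δ Γ≈Δ a with proj₁ (Γ≈Δ _) (a , refl , refl)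
... | c , _ , jc = c , jc

sameSet-refl : ∀ {k m} (Γ : SOS k m) → SameSet Γ Γ
sameSet-refl Γ x = id , id

sos-j-nonconstant : ∀ {k m} → 2 ≤ k → (Γ : SOS k m) (c : Fin m) →
  ¬ (∀ a → Root.j (lookup (SOS.roots Γ) a) ≡ c)
sos-j-nonconstant (s≤s (s≤s _)) Γ c j≡c =
  proj₂ (proj₂ (proj₂ (SOS.pairwise Γ zero (suc zero) (λ ()))))
        (trans (j≡c zero) (sym (j≡c (suc zero))))

clique-of-differences : ∀ {k m} {I : Set} (v₀ : Fin m → ℤ) (v : I → Fin m → ℤ) (F : I → SOS k m) →
  (∀ i x → ∣ F i ∣Γ x ≡ v₀ x - v i x) →
  (∀ i j → i ≢ j → Σ (SOS k m) λ G → ∀ x → ∣ G ∣Γ x ≡ v j x - v i x) →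
  IsSOSClique F
clique-of-differences v₀ v F ∣F∣ realised a b F≉F with realised a b (λ { refl → F≉F (sameSet-refl (F a)) })
... | G , ∣G∣ = G , λ x → begin
  ∣ F a ∣Γ x - ∣ F b ∣Γ x            ≡⟨ cong₂ _-_ (∣F∣ a x) (∣F∣ b x) ⟩
  (v₀ x - v a x) - (v₀ x - v b x)    ≡⟨ solve 3 (λ u s t → (u :- s) :- (u :- t) := t :- s) refl
                                          (v₀ x) (v a x) (v b x) ⟩
  v b x - v a x                      ≡⟨ ∣G∣ x ⟨
  ∣ G ∣Γ x                           ∎
  where
  open ≡-Reasoning
  open +-*-Solver

module ProjectivePlane {q} {N : Fin (PPn q) → Fin (PPn q) → Bool} (plane : IsProjectivePlane q N) where
  open IsProjectivePlane plane

  pointsOfLineExcept : ∀ l p → N l p ≡ true → Enumeration (without p (N l)) q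
  pointsOfLineExcept l p p∈l =
    enumerationOfSize (ℕP.suc-injective (trans (sym (count-without p (N l) p∈l)) (lineSize l)))

  module _ {l l′ : Fin (PPn q)} (l≢l′ : l ≢ l′) where

    private
      p : Fin (PPn q)
      p = proj₁ (linesMeet l l′ l≢l′)

      p∈l : N l p ≡ true
      p∈l = proj₁ (proj₂ (linesMeet l l′ l≢l′))

      p∈l′ : N l′ p ≡ true
      p∈l′ = proj₁ (proj₂ (proj₂ (linesMeet l l′ l≢l′)))

      p-unique : ∀ y → N l y ≡ true → N l′ y ≡ true → y ≡ p
      p-unique = proj₂ (proj₂ (proj₂ (linesMeet l l′ l≢l′)))

      L : Enumeration (without p (N l)) q
      L = pointsOfLineExcept l p p∈l

      L′ : Enumeration (without p (N l′)) q
      L′ = pointsOfLineExcept l′ p p∈l′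

      disjoint : ∀ a b → lookup (elems L) a ≢ lookup (elems L′) b
      disjoint a b y≡y′ = y≢p (p-unique y y∈l (subst (λ z → N l′ z ≡ true) (sym y≡y′) y′∈l′))
        where
        y : Fin (PPn q)
        y = lookup (elems L) a
        y≢p : y ≢ p
        y≢p = proj₁ (without-true p (N l) (elems-true L a))
        y∈l : N l y ≡ true
        y∈l = proj₂ (without-true p (N l) (elems-true L a))
        y′∈l′ : N l′ (lookup (elems L′) b) ≡ true
        y′∈l′ = proj₂ (without-true p (N l′) (elems-true L′ b))

      open DisjointMatching {as = elems L} {bs = elems L′} (elems-inj L) (elems-inj L′) disjoint

    lineDifference : SOS q (PPn q)
    lineDifference = disjointMatching

    ∣lineDifference∣ : ∀ x → ∣ lineDifference ∣Γ x ≡ row N l x - row N l′ x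
    ∣lineDifference∣ x = begin
      ∣ lineDifference ∣Γ x
        ≡⟨ ∣disjointMatching∣ x ⟩
      occurrences x (elems L) - occurrences x (elems L′)
        ≡⟨ cong₂ _-_ (occurrences≡f L x) (occurrences≡f L′ x) ⟩
      b2ℤ (without p (N l) x) - b2ℤ (without p (N l′) x)
        ≡⟨ b2ℤ-without-difference p (N l) (N l′) (trans p∈l (sym p∈l′)) x ⟩
      row N l x - row N l′ x
        ∎
      where open ≡-Reasoning

    lineDifference-j∈l′ : ∀ a → N l′ (Root.j (lookup (SOS.roots lineDifference) a)) ≡ true
    lineDifference-j∈l′ a =
      subst (λ y → N l′ y ≡ true) (sym (disjointMatching-j a))
            (proj₂ (without-true p (N l′) (elems-true L′ a)))

  lineDifference-injective : 2 ≤ q → ∀ {l l′ l″} (l≢l′ : l ≢ l′) (l≢l″ : l ≢ l″) → l′ ≢ l″ →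
    ¬ SameSet (lineDifference l≢l′) (lineDifference l≢l″)
  lineDifference-injective 2≤q {l′ = l′} {l″} l≢l′ l≢l″ l′≢l″ Γ≈Δ =
    sos-j-nonconstant 2≤q (lineDifference l≢l′) (proj₁ (linesMeet l′ l″ l′≢l″)) j≡meet
    where
    j∈l″ : ∀ a → N l″ (Root.j (lookup (SOS.roots (lineDifference l≢l′)) a)) ≡ true
    j∈l″ a with sameSet-j (lineDifference l≢l′) (lineDifference l≢l″) Γ≈Δ a
    ... | c , jc = subst (λ y → N l″ y ≡ true) jc (lineDifference-j∈l′ l≢l″ c)
    j≡meet : ∀ a → Root.j (lookup (SOS.roots (lineDifference l≢l′)) a) ≡ proj₁ (linesMeet l′ l″ l′≢l″)
    j≡meet a = proj₂ (proj₂ (proj₂ (linesMeet l′ l″ l′≢l″))) _ (lineDifference-j∈l′ l≢l′ a) (j∈l″ a)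

proposition4p1 : (q : ℕ) → 2 ≤ q →
    (N : Fin (PPn q) → Fin (PPn q) → Bool) → IsProjectivePlane q N →
    Σ (Fin (q * q + q) → SOS q (PPn q)) λ Γ →
      (∀ i x → ∣ Γ i ∣Γ x ≡ row N zero x - row N (suc i) x) ×
      IsSOSClique Γ ×
      (∀ i j → i ≢ j → ¬ SameSet (Γ i) (Γ j))
proposition4p1 q 2≤q N plane =
  Γ , ∣Γ∣ , clique-of-differences (row N zero) (row N ∘ suc) Γ ∣Γ∣ realised ,
  λ i j i≢j → lineDifference-injective 2≤q (λ ()) (λ ()) (i≢j ∘ suc-injective)
  where
  open ProjectivePlane plane
  Γ : Fin (q * q + q) → SOS q (PPn q)
  Γ i = lineDifference {zero} {suc i} (λ ())
  ∣Γ∣ : ∀ i x → ∣ Γ i ∣Γ x ≡ row N zero x - row N (suc i) x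
  ∣Γ∣ i = ∣lineDifference∣ (λ ())
  realised : ∀ i j → i ≢ j → Σ (SOS q (PPn q)) λ G → ∀ x → ∣ G ∣Γ x ≡ row N (suc j) x - row N (suc i) x
  realised i j i≢j = lineDifference (i≢j ∘ suc-injective ∘ sym) , ∣lineDifference∣ _
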